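{- Let $X$ be a (non-skew) tableau. Then the associated circled array of $X$ consists only of empty rows.
   Context: Young diagrams are in English notation, rows indexed $i=1,2,\dots$ from the top. A skew tableau of shape $\lambda/\mu$ is a filling of $\lambda/\mu$ by positive integers weakly increasing along rows and strictly increasing down columns; a (non-skew) tableau is the case $\mu=\emptyset$. For a skew tableau $S$ of shape $\lambda/\mu$, regard the boxes of $\mu$ as empty boxes carrying the number $0$; for $i\ge1$, $j\ge0$ let $c_{i,j}$ be the number of boxes of row $i$ of $\lambda$ (empty ones included) whose number is $\le j$, and $W_{i,j}=c_{i,j}-c_{i+1,j+1}$. Let $w_j$ be the one-rowed array (weakly increasing sequence) consisting of $W_{1,j}$ copies of $1$, $W_{2,j}$ copies of $2$, \dots. A circled array is a finite list of rows, each a finite (possibly empty) weakly increasing sequence of positive integers (circled numbers). For a circled array $A=(r_1,\dots,r_m)$ and a one-rowed array $x$, $A\leftharpoonup x$ is defined: put $x^{(1)}=x$; for $p=1,\dots,m$, arrange the entries of $r_p$ (balls) and of $x^{(p)}$ (empty boxes) in a line in the order circled $1$'s, boxed $1$'s, circled $2$'s, boxed $2$'s, \dots; going through the balls from left to right move each ball to the nearest position to its right that is empty at that moment (a ball with no such position is removed); then each position that held a ball and is now empty becomes a box of value $v-1$ ($v$ its old value), each box now holding a ball becomes circled with unchanged value, and boxed $0$'s are deleted; the circled values form the new row $r'_p$ and the boxed values form $x^{(p+1)}$. Then $A\leftharpoonup x=(r'_1,\dots,r'_m,x^{(m+1)})$ with $x^{(m+1)}$ as a circled last row. $x_1\leftharpoonup\cdots\leftharpoonup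 x_n$ is obtained from the array with no rows by acting successively with $x_1,\dots,x_n$. The associated circled array of $S$ is $w_N\leftharpoonup w_{N-1}\leftharpoonup\cdots\leftharpoonup w_0$ for $N$ sufficiently large. -}

module Defs where

open import Data.Nat using (ℕ; zero; suc; _+_; _∸_; _≤_; _<_; _≤?_; _≤ᵇ_)
open import Data.List using (List; []; _∷_; length; filter; map; concat; replicate; upTo; downFrom; foldl)
open import Data.List.Relation.Unary.All using (All)
open import Data.List.Relation.Unary.Linked using (Linked)
open import Data.Product using (_×_; _,_; proj₁; proj₂)
open import Data.Bool using (if_then_else_)
open import Data.Sum using (_⊎_)
open import Relation.Binary.PropositionalEquality using (_≡_)

-- A skew tableau of shape λ/μ is a list of rows (row 1
-- first); row i is the list of the λ_i numbers in row i of λ, read left to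
-- right, where the μ_i boxes of μ are the empty boxes carrying the number 0
-- (as in the paper).  Trailing rows of length 0 are harmless.

-- entry k (0-based column) of a row, default 0 outside the row
nth : List ℕ → ℕ → ℕ
nth []       _       = 0
nth (x ∷ _)  zero    = x
nth (_ ∷ xs) (suc k) = nth xs k

countLe : ℕ → List ℕ → ℕ
countLe j r = length (filter (_≤? j) r)

WeaklyIncreasing : List ℕ → Set
WeaklyIncreasing = Linked _≤_

ColumnStrict : List ℕ → List ℕ → Set
ColumnStrict r s = ∀ k → k < length s → (nth s k ≡ 0) ⊎ (nth r k < nth s k)

IsSkewTableau : List (List ℕ) → Set
IsSkewTableau T =
    All WeaklyIncreasing T                                -- rows weakly increase (empty 0-boxes first)
  × Linked (λ r s → length s ≤ length r) T                 -- λ is a partition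
  × Linked (λ r s → countLe 0 s ≤ countLe 0 r) T           -- μ is a partition
  × Linked ColumnStrict T                                  -- columns strictly increase (on filled boxes)

-- a (non-skew) tableau: μ = ∅, i.e. every box carries a positive integer
IsTableau : List (List ℕ) → Set
IsTableau T = IsSkewTableau T × All (All (λ x → 0 < x)) T

-- c_{i,j}, W_{i,j}, w_j   (rows indexed from 1; rows beyond the diagram are empty)

rowAt : List (List ℕ) → ℕ → List ℕ
rowAt []      _             = []
rowAt (_ ∷ _) zero          = []          -- there is no row 0
rowAt (r ∷ _) (suc zero)    = r
rowAt (_ ∷ T) (suc (suc i)) = rowAt T (suc i)

c : List (List ℕ) → ℕ → ℕ → ℕ
c T i j = countLe j (rowAt T i)

-- (for a skew tableau c_{i,j} ≥ c_{i+1,j+1}, so truncated subtraction is exact)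
W : List (List ℕ) → ℕ → ℕ → ℕ
W T i j = c T i j ∸ c T (suc i) (suc j)

-- one-rowed array: W_{1,j} copies of 1, W_{2,j} copies of 2, ...
-- (W_{i,j} = 0 for i > number of rows)
w : List (List ℕ) → ℕ → List ℕ
w T j = concat (map (λ i → replicate (W T (suc i) j) (suc i)) (upTo (length T)))

CircledArray : Set
CircledArray = List (List ℕ)

data Pos : Set where
  ball : ℕ → Pos   -- a ball (circled number) not yet moved
  box  : ℕ → Pos   -- an empty box (boxed number)
  full : ℕ → Pos   -- a box (of the given value) now holding a ball
  hole : ℕ → Pos   -- a position that held a ball of the given value and is now empty

-- arrange balls (circled row r) and empty boxes (x): circled 1's, boxed 1's,
-- circled 2's, boxed 2's, ...  (both inputs are weakly increasing)
arrange : List ℕ → List ℕ → List Pos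
arrange []       xs       = map box xs
arrange (b ∷ bs) []       = map ball (b ∷ bs)
arrange (b ∷ bs) (x ∷ xs) =
  if b ≤ᵇ x then ball b ∷ arrange bs (x ∷ xs) else box x ∷ arrange (b ∷ bs) xs

-- move a ball into the nearest empty box (leftmost `box`) of the given line;
-- if there is none the ball is removed (line unchanged)
place : List Pos → List Pos
place []            = []
place (box v ∷ ps)  = full v ∷ ps
place (p ∷ ps)      = p ∷ place ps

-- go through the balls from left to right (fuel = length of the line);
-- a moved ball leaves a hole behind it.  Empty positions to the right of the
-- current ball are exactly the `box` cells, since holes only arise to its left.
moveBalls : ℕ → List Pos → List Pos
moveBalls zero    ps            = ps
moveBalls (suc n) []            = []
moveBalls (suc n) (ball v ∷ ps) = hole v ∷ moveBalls n (place ps)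
moveBalls (suc n) (p ∷ ps)      = p ∷ moveBalls n ps

circledOf : List Pos → List ℕ
circledOf []            = []
circledOf (full v ∷ ps) = v ∷ circledOf ps
circledOf (_ ∷ ps)      = circledOf ps

-- boxed values of the result: holes of value v become boxes of value v-1,
-- remaining empty boxes keep their value; boxed 0's are deleted
boxedOf : List Pos → List ℕ
boxedOf []                  = []
boxedOf (hole zero ∷ ps)          = boxedOf ps           -- (value-0 ball: does not occur)
boxedOf (hole (suc zero) ∷ ps)    = boxedOf ps           -- becomes boxed 0: deleted
boxedOf (hole (suc (suc v)) ∷ ps) = suc v ∷ boxedOf ps
boxedOf (box zero ∷ ps)     = boxedOf ps
boxedOf (box (suc v) ∷ ps)  = suc v ∷ boxedOf ps
boxedOf (_ ∷ ps)            = boxedOf ps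

step : List ℕ → List ℕ → List ℕ × List ℕ
step r x = circledOf line , boxedOf line
  where
  ps   = arrange r x
  line = moveBalls (length ps) ps

infixl 5 _↼_
_↼_ : CircledArray → List ℕ → CircledArray
[]      ↼ x = x ∷ []
(r ∷ A) ↼ x = proj₁ (step r x) ∷ (A ↼ proj₂ (step r x))

-- w_N ↼ w_{N-1} ↼ ... ↼ w_0, starting from the array with no rows
circledArrayN : List (List ℕ) → ℕ → CircledArray
circledArrayN T N = foldl _↼_ [] (map (w T) (downFrom (suc N)))

-- In a tableau the entries of row i are at least i, so c_{i,j} = 0 for j < i and
-- w_j only contains numbers in 1..j.  The action of a one-rowed array with
-- numbers in 1..j on a circled array with numbers in 1..j+1 yields numbers in
-- 1..j: every ball lands in a box of value ≤ j or is removed, and every hole of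
-- value v ≤ j+1 becomes a box of value v-1 ≤ j.  Hence after acting with
-- w_N, ..., w_j all circled numbers lie in 1..j, and after w_0 no number is left.
module Submission where

open import Defs
open import Data.Nat using (ℕ; zero; suc; _+_; _∸_; _≤_; _<_; z≤n; s≤s; _≤?_; _≤ᵇ_)
open import Data.Nat.Properties using (≤-trans; <-≤-trans; +-suc; +-comm; 0∸n≡0; ≰⇒>; <⇒≱; n≮0)
open import Data.List using (List; []; _∷_; length; map; replicate; upTo; downFrom; foldl)
open import Data.List.Properties using (filter-none)
open import Data.List.Relation.Unary.All as All using (All; []; _∷_)
open import Data.List.Relation.Unary.All.Properties using (map⁺; concat⁺; replicate⁺)
open import Data.List.Relation.Unary.Linked using (Linked; _∷_)
open import Data.Product using (∃; _×_; _,_; proj₁; proj₂)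
open import Data.Sum using (inj₁; inj₂)
open import Data.Bool using (true; false; if_then_else_)
open import Data.Empty using (⊥-elim)
open import Relation.Nullary using (yes; no)
open import Relation.Binary.PropositionalEquality using (_≡_; refl; subst; cong)

All-if : ∀ {A : Set} {P : A → Set} b {t e : List A} → All P t → All P e →
         All P (if b then t else e)
All-if true  pt _  = pt
All-if false _  pe = pe

Within : ℕ → ℕ → Set
Within j v = 0 < v × v ≤ j

Bounded : ℕ → List ℕ → Set
Bounded j = All (Within j)

-- A hole of value v becomes a box of value v-1 (deleted when v = 1), so holes
-- may carry the old bound j+1 and need no positivity.
PosWithin : ℕ → Pos → Set
PosWithin j (ball v) = Within (suc j) v
PosWithin j (box v)  = Within j v
PosWithin j (full v) = Within j v
PosWithin j (hole v) = v ≤ suc j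

module _ {j : ℕ} where

  arrange-within : ∀ r x → Bounded (suc j) r → Bounded j x → All (PosWithin j) (arrange r x)
  arrange-within []       x        _        px = map⁺ px
  arrange-within (b ∷ bs) []       pr       _  = map⁺ pr
  arrange-within (b ∷ bs) (x ∷ xs) (pb ∷ pr) (px ∷ pxs) =
    All-if (b ≤ᵇ x) (pb ∷ arrange-within bs (x ∷ xs) pr (px ∷ pxs))
                    (px ∷ arrange-within (b ∷ bs) xs (pb ∷ pr) pxs)

  place-within : ∀ ps → All (PosWithin j) ps → All (PosWithin j) (place ps)
  place-within []            []      = []
  place-within (ball v ∷ ps) (p ∷ q) = p ∷ place-within ps q
  place-within (box v ∷ ps)  (p ∷ q) = p ∷ q
  place-within (full v ∷ ps) (p ∷ q) = p ∷ place-within ps q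
  place-within (hole v ∷ ps) (p ∷ q) = p ∷ place-within ps q

  moveBalls-within : ∀ n ps → All (PosWithin j) ps → All (PosWithin j) (moveBalls n ps)
  moveBalls-within zero    ps            q       = q
  moveBalls-within (suc n) []            []      = []
  moveBalls-within (suc n) (ball v ∷ ps) (p ∷ q) = proj₂ p ∷ moveBalls-within n (place ps) (place-within ps q)
  moveBalls-within (suc n) (box v ∷ ps)  (p ∷ q) = p ∷ moveBalls-within n ps q
  moveBalls-within (suc n) (full v ∷ ps) (p ∷ q) = p ∷ moveBalls-within n ps q
  moveBalls-within (suc n) (hole v ∷ ps) (p ∷ q) = p ∷ moveBalls-within n ps q

  circledOf-bounded : ∀ ps → All (PosWithin j) ps → Bounded j (circledOf ps)
  circledOf-bounded []            []      = []
  circledOf-bounded (ball v ∷ ps) (p ∷ q) = circledOf-bounded ps q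
  circledOf-bounded (box v ∷ ps)  (p ∷ q) = circledOf-bounded ps q
  circledOf-bounded (full v ∷ ps) (p ∷ q) = p ∷ circledOf-bounded ps q
  circledOf-bounded (hole v ∷ ps) (p ∷ q) = circledOf-bounded ps q

  boxedOf-bounded : ∀ ps → All (PosWithin j) ps → Bounded j (boxedOf ps)
  boxedOf-bounded []                        []          = []
  boxedOf-bounded (ball v ∷ ps)             (p ∷ q)     = boxedOf-bounded ps q
  boxedOf-bounded (box zero ∷ ps)           (p ∷ q)     = boxedOf-bounded ps q
  boxedOf-bounded (box (suc v) ∷ ps)        (p ∷ q)     = p ∷ boxedOf-bounded ps q
  boxedOf-bounded (full v ∷ ps)             (p ∷ q)     = boxedOf-bounded ps q
  boxedOf-bounded (hole zero ∷ ps)          (p ∷ q)     = boxedOf-bounded ps q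
  boxedOf-bounded (hole (suc zero) ∷ ps)    (p ∷ q)     = boxedOf-bounded ps q
  boxedOf-bounded (hole (suc (suc v)) ∷ ps) (s≤s p ∷ q) = (s≤s z≤n , p) ∷ boxedOf-bounded ps q

  step-bounded : ∀ r x → Bounded (suc j) r → Bounded j x →
                 Bounded j (proj₁ (step r x)) × Bounded j (proj₂ (step r x))
  step-bounded r x pr px = circledOf-bounded _ line , boxedOf-bounded _ line
    where
    line : All (PosWithin j) (moveBalls (length (arrange r x)) (arrange r x))
    line = moveBalls-within _ _ (arrange-within r x pr px)

  ↼-bounded : ∀ A x → All (Bounded (suc j)) A → Bounded j x → All (Bounded j) (A ↼ x)
  ↼-bounded []      x []        px = px ∷ []
  ↼-bounded (r ∷ A) x (pr ∷ pA) px =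
    proj₁ (step-bounded r x pr px) ∷ ↼-bounded A _ pA (proj₂ (step-bounded r x pr px))

All⇒nth : ∀ {P : ℕ → Set} r k → All P r → k < length r → P (nth r k)
All⇒nth (x ∷ r) zero    (p ∷ _) _        = p
All⇒nth (x ∷ r) (suc k) (_ ∷ q) (s≤s lt) = All⇒nth r k q lt

nth⇒All : ∀ {P : ℕ → Set} s → (∀ k → k < length s → P (nth s k)) → All P s
nth⇒All []      f = []
nth⇒All (x ∷ s) f = f zero (s≤s z≤n) ∷ nth⇒All s (λ k lt → f (suc k) (s≤s lt))

columnStrict-raises : ∀ {m r s} → All (m ≤_) r → ColumnStrict r s → length s ≤ length r →
                      All (0 <_) s → All (suc m ≤_) s
columnStrict-raises {m} {r} {s} pr cs len ps = nth⇒All s above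
  where
  above : ∀ k → k < length s → suc m ≤ nth s k
  above k lt with cs k lt | All⇒nth s k ps lt
  ... | inj₁ eq  | pos = ⊥-elim (n≮0 (subst (0 <_) eq pos))
  ... | inj₂ lt′ | _   = <-≤-trans (s≤s (All⇒nth r k pr (<-≤-trans lt len))) lt′

rowAt-lowerBound : ∀ {m r X} → All (m ≤_) r → Linked ColumnStrict (r ∷ X) →
                   Linked (λ r s → length s ≤ length r) (r ∷ X) → All (All (0 <_)) X →
                   ∀ i → All (i + m ≤_) (rowAt (r ∷ X) (suc i))
rowAt-lowerBound pr _ _ _ zero              = pr
rowAt-lowerBound {X = []} _ _ _ _ (suc i) = []
rowAt-lowerBound {m} {X = s ∷ X} pr (cs ∷ css) (len ∷ lens) (ps ∷ pss) (suc i) =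
  subst (λ n → All (n ≤_) (rowAt (s ∷ X) (suc i))) (+-suc i m)
    (rowAt-lowerBound (columnStrict-raises pr cs len ps) css lens pss i)

tableau-rowAt-≥ : ∀ {X} → IsTableau X → ∀ i → All (suc i ≤_) (rowAt X (suc i))
tableau-rowAt-≥ {[]}    _                                i = []
tableau-rowAt-≥ {r ∷ X} ((_ , lens , _ , css) , pr ∷ pss) i =
  subst (λ n → All (n ≤_) (rowAt (r ∷ X) (suc i))) (+-comm i 1)
    (rowAt-lowerBound pr css lens pss i)

countLe-none : ∀ {j} row → All (j <_) row → countLe j row ≡ 0
countLe-none {j} row p = cong length (filter-none (_≤? j) (All.map <⇒≱ p))

tableau-c-vanishes : ∀ {X} → IsTableau X → ∀ {i j} → j ≤ i → c X (suc i) j ≡ 0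
tableau-c-vanishes {X} tX {i} j≤i =
  countLe-none (rowAt X (suc i)) (All.map (≤-trans (s≤s j≤i)) (tableau-rowAt-≥ tX i))

tableau-W-vanishes : ∀ {X} → IsTableau X → ∀ {i j} → j ≤ i → W X (suc i) j ≡ 0
tableau-W-vanishes {X} tX {i} {j} j≤i rewrite tableau-c-vanishes tX j≤i =
  0∸n≡0 (c X (suc (suc i)) (suc j))

w-bounded : ∀ {X} → IsTableau X → ∀ j → Bounded j (w X j)
w-bounded {X} tX j = concat⁺ (map⁺ (All.universal copies (upTo (length X))))
  where
  copies : ∀ i → Bounded j (replicate (W X (suc i) j) (suc i))
  copies i with j ≤? i
  ... | yes j≤i rewrite tableau-W-vanishes tX j≤i = []
  ... | no  j≰i = replicate⁺ _ (s≤s z≤n , ≰⇒> j≰i)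

foldl-↼-w-bounded : ∀ {X} → IsTableau X → ∀ j A → All (Bounded (suc j)) A →
              All (Bounded 0) (foldl _↼_ A (map (w X) (downFrom (suc j))))
foldl-↼-w-bounded tX zero    A pA = ↼-bounded A _ pA (w-bounded tX 0)
foldl-↼-w-bounded tX (suc j) A pA =
  foldl-↼-w-bounded tX j (A ↼ _) (↼-bounded A _ pA (w-bounded tX (suc j)))

Bounded-0-empty : ∀ {row} → Bounded 0 row → row ≡ []
Bounded-0-empty []               = refl
Bounded-0-empty ((() , z≤n) ∷ _)

lemma3p7 : (X : List (List ℕ)) → IsTableau X →
    ∃ λ N₀ → (N : ℕ) → N₀ ≤ N → All (λ row → row ≡ []) (circledArrayN X N)
lemma3p7 X tX = 0 , λ N _ → All.map Bounded-0-empty (foldl-↼-w-bounded tX N [] [])
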